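{- Let $\mathscr{F}=(X,I)$ be a connected quasi-$1$-plane. Then the following are equivalent: (a) $\mathscr{F}$ is elliptic; (b) $I^3$ is reflexive; (c) there exists an element $a\in X$ with $aI^3a$.
   Context: A $1$-frame is $(X,I)$ with $I\subseteq X\times X$; $I^n$ is the $n$-fold composition of $I$. A quasi-$1$-plane is a $1$-frame with $I$ serial, symmetric, and satisfying $aI^4b\Rightarrow aI^2b$ for all $a,b$; in it $I^2$ is an equivalence relation. It is connected if any two elements are joined by a finite $(I\cup I^{ -1})$-path. A connected quasi-$1$-plane is elliptic if $I^2$ has exactly one equivalence class. -}

module Defs where

open import Level using (Level; _⊔_; suc)
open import Data.Nat using (ℕ; zero) renaming (suc to sucℕ)
open import Data.Product using (Σ; ∃; _×_; _,_)
open import Data.Sum using (_⊎_)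
open import Relation.Binary.PropositionalEquality using (_≡_)
open import Relation.Binary.Construct.Closure.ReflexiveTransitive using (Star)

record Frame (a ℓ : Level) : Set (Level.suc (a ⊔ ℓ)) where
  field
    X : Set a
    I : X → X → Set ℓ

module _ {a ℓ : Level} (F : Frame a ℓ) where
  open Frame F

  Iˆ : ℕ → X → X → Set (a ⊔ ℓ)
  Iˆ zero x y = Level.Lift (a ⊔ ℓ) (x ≡ y)
  Iˆ (sucℕ n) x y = ∃ λ z → Iˆ n x z × I z y

  Serial : Set (a ⊔ ℓ)
  Serial = ∀ x → ∃ λ y → I x y

  Symmetric : Set (a ⊔ ℓ)
  Symmetric = ∀ {x y} → I x y → I y x

  Reflexive : (X → X → Set (a ⊔ ℓ)) → Set (a ⊔ ℓ)
  Reflexive R = ∀ x → R x x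

  record QuasiOnePlane : Set (a ⊔ ℓ) where
    field
      serial    : Serial
      symmetric : Symmetric
      four⇒two  : ∀ x y → Iˆ 4 x y → Iˆ 2 x y

  I± : X → X → Set ℓ
  I± x y = I x y ⊎ I y x

  record Connected : Set (a ⊔ ℓ) where
    field
      inhabitant : X
      path       : ∀ x y → Star I± x y

  -- elliptic: I² (an equivalence relation here) has exactly one equivalence class,
  -- i.e. there is an element and all elements are I²-related.
  Elliptic : Set (a ⊔ ℓ)
  Elliptic = X × (∀ x y → Iˆ 2 x y)

-- Since I⁴ ⊆ I², a step y I x followed by a loop x I³ x gives y I² x.  Hence an I³-loop
-- at x yields one at every neighbour y (via y I² x I y), and if every point carries an
-- I³-loop then every edge lies in the equivalence relation I², which by connectedness
-- is then total.  Conversely, in an elliptic plane x I² y I x for any neighbour y of x.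
module Submission where

open import Defs
open import Level using (lift)
open import Data.Nat using (zero; suc; _+_)
open import Data.Product using (∃; _×_; _,_)
open import Data.Sum using (inj₁; inj₂)
open import Function.Base using (_∘_)
open import Function.Bundles using (_⇔_; mk⇔)
open import Relation.Binary.PropositionalEquality using (refl)
open import Relation.Binary.Construct.Closure.ReflexiveTransitive using (fold)

module FrameProperties {a ℓ} (F : Frame a ℓ) where
  open Frame F

  Iˆ-+ : ∀ {x y z} m n → Iˆ F m x y → Iˆ F n y z → Iˆ F (n + m) x z
  Iˆ-+ m zero    p (lift refl)    = p
  Iˆ-+ m (suc n) p (w , q , r) = w , Iˆ-+ m n p q , r

  I⇒Iˆ¹ : ∀ {x y} → I x y → Iˆ F 1 x y
  I⇒Iˆ¹ {x} p = x , lift refl , p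

module QuasiOnePlaneProperties {a ℓ} (F : Frame a ℓ) (Q : QuasiOnePlane F) where
  open Frame F
  open QuasiOnePlane Q
  open FrameProperties F

  I±⇒I : ∀ {x y} → I± F x y → I x y
  I±⇒I (inj₁ p) = p
  I±⇒I (inj₂ p) = symmetric p

  Iˆ²-refl : ∀ x → Iˆ F 2 x x
  Iˆ²-refl x = let (y , p) = serial x in y , I⇒Iˆ¹ p , symmetric p

  Iˆ²-trans : ∀ {x y z} → Iˆ F 2 x y → Iˆ F 2 y z → Iˆ F 2 x z
  Iˆ²-trans p q = four⇒two _ _ (Iˆ-+ 2 2 p q)

  I∘Iˆ³⇒Iˆ² : ∀ {x y z} → I x y → Iˆ F 3 y z → Iˆ F 2 x z
  I∘Iˆ³⇒Iˆ² p q = four⇒two _ _ (Iˆ-+ 1 3 (I⇒Iˆ¹ p) q)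

  Iˆ³-loop-step : ∀ {x y} → I x y → Iˆ F 3 x x → Iˆ F 3 y y
  Iˆ³-loop-step {x} p loop = x , I∘Iˆ³⇒Iˆ² (symmetric p) loop , p

  elliptic⇒Iˆ³-refl : Elliptic F → Reflexive F (Iˆ F 3)
  elliptic⇒Iˆ³-refl (_ , total) x = let (y , p) = serial x in y , total x y , symmetric p

  Iˆ³-refl⇒I⊆Iˆ² : Reflexive F (Iˆ F 3) → ∀ {x y} → I x y → Iˆ F 2 x y
  Iˆ³-refl⇒I⊆Iˆ² loops {y = y} p = I∘Iˆ³⇒Iˆ² p (loops y)

  module _ (C : Connected F) where
    open Connected C

    Iˆ³-refl⇒elliptic : Reflexive F (Iˆ F 3) → Elliptic F
    Iˆ³-refl⇒elliptic loops = inhabitant , λ x y →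
      fold (Iˆ F 2) (Iˆ²-trans ∘ Iˆ³-refl⇒I⊆Iˆ² loops ∘ I±⇒I) (Iˆ²-refl _) (path x y)

    Iˆ³-loop⇒Iˆ³-refl : (∃ λ x → Iˆ F 3 x x) → Reflexive F (Iˆ F 3)
    Iˆ³-loop⇒Iˆ³-refl (x , loop) y =
      fold (λ u v → Iˆ F 3 u u → Iˆ F 3 v v)
           (λ e k → k ∘ Iˆ³-loop-step (I±⇒I e)) (λ l → l) (path x y) loop

lemma6p3 : ∀ {a ℓ} (F : Frame a ℓ) → QuasiOnePlane F → Connected F →
    (Elliptic F ⇔ Reflexive F (Iˆ F 3))
      × (Reflexive F (Iˆ F 3) ⇔ (∃ λ x → Iˆ F 3 x x))
lemma6p3 F Q C =
  mk⇔ elliptic⇒Iˆ³-refl (Iˆ³-refl⇒elliptic C) ,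
  mk⇔ (λ loops → inhabitant , loops inhabitant) (Iˆ³-loop⇒Iˆ³-refl C)
  where
  open QuasiOnePlaneProperties F Q
  open Connected C using (inhabitant)
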